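{- Let $G=(U,V,E)$ be a bipartite graph, $k\ge 0$ an integer, and $D=(U_D,V_D,E_D)$ a $k$-defective biclique of $G$ with $|U_D|>k$ and $|V_D|>k$. Then any two vertices of $D$ are at distance at most $3$ in $D$.
   Context: A bipartite graph $G=(U,V,E)$ has disjoint vertex sets $U,V$ and $E\subseteq U\times V$. A $k$-defective biclique of $G$ is a subgraph $D=(U_D,V_D,E_D)$ with $U_D\subseteq U$, $V_D\subseteq V$, $E_D\subseteq E\cap(U_D\times V_D)$ and $|(U_D\times V_D)\setminus E_D|\le k$. Distance means shortest-path length. -}

module Defs where

open import Data.Nat using (ℕ; zero; suc; _+_; _≤_; _<_)
open import Data.Bool using (Bool; true; false; _∧_; not; if_then_else_; T)
open import Data.Fin using (Fin)
open import Data.Fin.Subset using (Subset)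
open import Data.Vec using (lookup)
open import Data.List using (List; []; _∷_; map; allFin)
open import Data.Nat.ListAction using (sum)
open import Data.Sum using (_⊎_; inj₁; inj₂)
open import Data.Product using (_×_; Σ; ∃; _,_)
open import Data.Empty using (⊥)
open import Relation.Binary.PropositionalEquality using (_≡_)

record BipGraph : Set where
  field
    m : ℕ
    n : ℕ
    E : Fin m → Fin n → Bool
open BipGraph public

record BipSubgraph (G : BipGraph) : Set where
  field
    UD : Subset (m G)
    VD : Subset (n G)
    ED : Fin (m G) → Fin (n G) → Bool
    ED⊆E  : ∀ u v → T (ED u v) → T (E G u v)
    ED⊆UD : ∀ u v → T (ED u v) → T (lookup UD u)
    ED⊆VD : ∀ u v → T (ED u v) → T (lookup VD v)
open BipSubgraph public

missingPair : {G : BipGraph} → BipSubgraph G → Fin (m G) → Fin (n G) → ℕ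
missingPair D u v =
  if lookup (UD D) u ∧ lookup (VD D) v ∧ not (ED D u v) then 1 else 0

missingCount : {G : BipGraph} → BipSubgraph G → ℕ
missingCount {G} D =
  sum (map (λ u → sum (map (λ v → missingPair D u v) (allFin (n G)))) (allFin (m G)))

IsKDefectiveBiclique : (G : BipGraph) → ℕ → BipSubgraph G → Set
IsKDefectiveBiclique G k D = missingCount D ≤ k

Vertex : BipGraph → Set
Vertex G = Fin (m G) ⊎ Fin (n G)

InD : {G : BipGraph} → BipSubgraph G → Vertex G → Set
InD D (inj₁ u) = T (lookup (UD D) u)
InD D (inj₂ v) = T (lookup (VD D) v)

AdjD : {G : BipGraph} → BipSubgraph G → Vertex G → Vertex G → Set
AdjD D (inj₁ u) (inj₁ u') = ⊥
AdjD D (inj₁ u) (inj₂ v) = T (ED D u v)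
AdjD D (inj₂ v) (inj₁ u) = T (ED D u v)
AdjD D (inj₂ v) (inj₂ v') = ⊥

data WalkD {G : BipGraph} (D : BipSubgraph G) : Vertex G → Vertex G → ℕ → Set where
  here : ∀ {x} → WalkD D x x 0
  step : ∀ {x y z l} → AdjD D x y → WalkD D y z l → WalkD D x z (suc l)

DistD≤ : {G : BipGraph} → BipSubgraph G → Vertex G → Vertex G → ℕ → Set
DistD≤ D x y d = Σ ℕ (λ l → l ≤ d × WalkD D x y l)

{-# OPTIONS --safe #-}
-- If two vertices u₁, u₂ ∈ U_D had no common neighbour in D, every v ∈ V_D would
-- miss an edge to u₁ or to u₂, so D would miss at least |V_D| > k pairs; hence
-- vertices on the same side are at distance 2 (symmetrically for V_D).  For
-- u ∈ U_D and v ∈ V_D, take a neighbour v′ of u (a common neighbour of u with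
-- itself) and a common neighbour u′ of v′ and v: u – v′ – u′ – v.
module Submission where

open import Defs
open import Data.Nat using (ℕ; zero; suc; _+_; _≤_; _<_; z≤n)
open import Data.Nat.Properties
  using (≤-refl; ≤-trans; ≤-reflexive; n≤1+n; m≤m+n; +-mono-≤; <⇒≱; +-0-commutativeMonoid; module ≤-Reasoning)
open import Data.Bool using (Bool; true; false; if_then_else_; T)
open import Data.Bool.Properties using (T?)
open import Data.Fin using (Fin; zero; suc)
open import Data.Fin.Properties using (any?)
open import Data.Fin.Subset using (Subset; ∣_∣)
open import Data.Vec using (_∷_; []; lookup)
open import Data.List using (map; allFin; tabulate)
open import Data.List.Properties using (map-tabulate; map-cong)
open import Data.Nat.ListAction using (sum)
open import Data.Sum using (inj₁; inj₂)
open import Data.Product using (_×_; ∃-syntax; _,_)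
open import Function using (id; _∘_)
open import Relation.Nullary using (¬_; yes; no; contradiction)
open import Relation.Nullary.Decidable using (_×-dec_)
open import Relation.Binary.PropositionalEquality using (_≡_; refl; sym; trans; cong)
open import Algebra.Properties.CommutativeMonoid.Sum +-0-commutativeMonoid
  using (∑-comm; sum-remove; sum-syntax) renaming (sum to ∑)

𝟙 : Bool → ℕ
𝟙 b = if b then 1 else 0

𝟙-≤ : ∀ {b c} → (T b → 1 ≤ c) → 𝟙 b ≤ c
𝟙-≤ {false} _ = z≤n
𝟙-≤ {true}  h = h _

∣p∣≡∑𝟙 : ∀ {n} (p : Subset n) → ∣ p ∣ ≡ ∑[ i < n ] 𝟙 (lookup p i)
∣p∣≡∑𝟙 []          = refl
∣p∣≡∑𝟙 (true ∷ p)  = cong suc (∣p∣≡∑𝟙 p)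
∣p∣≡∑𝟙 (false ∷ p) = ∣p∣≡∑𝟙 p

sum-tabulate : ∀ {n} (f : Fin n → ℕ) → sum (tabulate f) ≡ ∑ f
sum-tabulate {zero}  f = refl
sum-tabulate {suc n} f = cong (f zero +_) (sum-tabulate (f ∘ suc))

sum-map-allFin : ∀ {n} (f : Fin n → ℕ) → sum (map f (allFin n)) ≡ ∑ f
sum-map-allFin f = trans (cong sum (map-tabulate id f)) (sum-tabulate f)

∑-mono-≤ : ∀ {n} {f g : Fin n → ℕ} → (∀ i → f i ≤ g i) → ∑ f ≤ ∑ g
∑-mono-≤ {zero}  f≤g = z≤n
∑-mono-≤ {suc n} f≤g = +-mono-≤ (f≤g zero) (∑-mono-≤ (f≤g ∘ suc))

≤-∑ : ∀ {n} (f : Fin n → ℕ) i → f i ≤ ∑ f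
≤-∑ {suc n} f i = ≤-trans (m≤m+n _ _) (≤-reflexive (sym (sum-remove f)))

module _ {G : BipGraph} (D : BipSubgraph G) where

  missingCount≡∑∑ : missingCount D ≡ ∑[ u < m G ] ∑[ v < n G ] missingPair D u v
  missingCount≡∑∑ =
    trans (cong sum (map-cong (λ u → sum-map-allFin (missingPair D u)) (allFin (m G))))
          (sum-map-allFin (λ u → ∑[ v < n G ] missingPair D u v))

  missingPair≡1 : ∀ {u v} → T (lookup (UD D) u) → T (lookup (VD D) v) → ¬ T (ED D u v) →
                  missingPair D u v ≡ 1
  missingPair≡1 {u} {v} u∈ v∈ ¬uv with lookup (UD D) u | lookup (VD D) v | ED D u v
  ... | true | true | false = refl
  ... | true | true | true  = contradiction _ ¬uv

  ∣UD∣≤missingCount : (∀ u → T (lookup (UD D) u) → ∃[ v ] missingPair D u v ≡ 1) →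
                      ∣ UD D ∣ ≤ missingCount D
  ∣UD∣≤missingCount missingInRow = begin
    ∣ UD D ∣                                       ≡⟨ ∣p∣≡∑𝟙 (UD D) ⟩
    ∑[ u < m G ] 𝟙 (lookup (UD D) u)               ≤⟨ ∑-mono-≤ (λ u → 𝟙-≤ (rowSum≥1 u)) ⟩
    ∑[ u < m G ] ∑[ v < n G ] missingPair D u v    ≡⟨ sym missingCount≡∑∑ ⟩
    missingCount D                                 ∎
    where
    open ≤-Reasoning
    rowSum≥1 : ∀ u → T (lookup (UD D) u) → 1 ≤ ∑[ v < n G ] missingPair D u v
    rowSum≥1 u u∈ with missingInRow u u∈
    ... | v , uv≡1 = ≤-trans (≤-reflexive (sym uv≡1)) (≤-∑ (missingPair D u) v)

  ∣VD∣≤missingCount : (∀ v → T (lookup (VD D) v) → ∃[ u ] missingPair D u v ≡ 1) →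
                      ∣ VD D ∣ ≤ missingCount D
  ∣VD∣≤missingCount missingInColumn = begin
    ∣ VD D ∣                                       ≡⟨ ∣p∣≡∑𝟙 (VD D) ⟩
    ∑[ v < n G ] 𝟙 (lookup (VD D) v)               ≤⟨ ∑-mono-≤ (λ v → 𝟙-≤ (columnSum≥1 v)) ⟩
    ∑[ v < n G ] ∑[ u < m G ] missingPair D u v    ≡⟨ sym (∑-comm (missingPair D)) ⟩
    ∑[ u < m G ] ∑[ v < n G ] missingPair D u v    ≡⟨ sym missingCount≡∑∑ ⟩
    missingCount D                                 ∎
    where
    open ≤-Reasoning
    columnSum≥1 : ∀ v → T (lookup (VD D) v) → 1 ≤ ∑[ u < m G ] missingPair D u v
    columnSum≥1 v v∈ with missingInColumn v v∈
    ... | u , uv≡1 = ≤-trans (≤-reflexive (sym uv≡1)) (≤-∑ (λ u → missingPair D u v) u)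

module _ {G : BipGraph} {k : ℕ} (D : BipSubgraph G) (kd : IsKDefectiveBiclique G k D) where

  commonNeighbourU : k < ∣ VD D ∣ → ∀ {u₁ u₂} → T (lookup (UD D) u₁) → T (lookup (UD D) u₂) →
                     ∃[ v ] T (ED D u₁ v) × T (ED D u₂ v)
  commonNeighbourU k<∣VD∣ {u₁} {u₂} u₁∈ u₂∈
    with any? (λ v → T? (ED D u₁ v) ×-dec T? (ED D u₂ v))
  ... | yes common = common
  ... | no ¬common = contradiction (≤-trans (∣VD∣≤missingCount D missingInColumn) kd) (<⇒≱ k<∣VD∣)
    where
    missingInColumn : ∀ v → T (lookup (VD D) v) → ∃[ u ] missingPair D u v ≡ 1
    missingInColumn v v∈ with T? (ED D u₁ v) | T? (ED D u₂ v)
    ... | no ¬u₁v | _        = u₁ , missingPair≡1 D u₁∈ v∈ ¬u₁v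
    ... | yes _   | no ¬u₂v  = u₂ , missingPair≡1 D u₂∈ v∈ ¬u₂v
    ... | yes u₁v | yes u₂v  = contradiction (v , u₁v , u₂v) ¬common

  commonNeighbourV : k < ∣ UD D ∣ → ∀ {v₁ v₂} → T (lookup (VD D) v₁) → T (lookup (VD D) v₂) →
                     ∃[ u ] T (ED D u v₁) × T (ED D u v₂)
  commonNeighbourV k<∣UD∣ {v₁} {v₂} v₁∈ v₂∈
    with any? (λ u → T? (ED D u v₁) ×-dec T? (ED D u v₂))
  ... | yes common = common
  ... | no ¬common = contradiction (≤-trans (∣UD∣≤missingCount D missingInRow) kd) (<⇒≱ k<∣UD∣)
    where
    missingInRow : ∀ u → T (lookup (UD D) u) → ∃[ v ] missingPair D u v ≡ 1
    missingInRow u u∈ with T? (ED D u v₁) | T? (ED D u v₂)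
    ... | no ¬uv₁ | _        = v₁ , missingPair≡1 D u∈ v₁∈ ¬uv₁
    ... | yes _   | no ¬uv₂  = v₂ , missingPair≡1 D u∈ v₂∈ ¬uv₂
    ... | yes uv₁ | yes uv₂  = contradiction (u , uv₁ , uv₂) ¬common

mainTheorem9 : (G : BipGraph) (k : ℕ) (D : BipSubgraph G) →
    IsKDefectiveBiclique G k D →
    k < ∣ UD D ∣ → k < ∣ VD D ∣ →
    (x y : Vertex G) → InD D x → InD D y → DistD≤ D x y 3
mainTheorem9 G k D kd k<∣UD∣ k<∣VD∣ (inj₁ u₁) (inj₁ u₂) u₁∈ u₂∈
  with v , u₁v , u₂v ← commonNeighbourU D kd k<∣VD∣ u₁∈ u₂∈
  = 2 , n≤1+n 2 , step {y = inj₂ v} u₁v (step u₂v here)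
mainTheorem9 G k D kd k<∣UD∣ k<∣VD∣ (inj₂ v₁) (inj₂ v₂) v₁∈ v₂∈
  with u , uv₁ , uv₂ ← commonNeighbourV D kd k<∣UD∣ v₁∈ v₂∈
  = 2 , n≤1+n 2 , step {y = inj₁ u} uv₁ (step uv₂ here)
mainTheorem9 G k D kd k<∣UD∣ k<∣VD∣ (inj₁ u) (inj₂ v) u∈ v∈
  with v′ , uv′ , _ ← commonNeighbourU D kd k<∣VD∣ u∈ u∈
  with u′ , u′v′ , u′v ← commonNeighbourV D kd k<∣UD∣ (ED⊆VD D u v′ uv′) v∈
  = 3 , ≤-refl , step {y = inj₂ v′} uv′ (step {y = inj₁ u′} u′v′ (step u′v here))
mainTheorem9 G k D kd k<∣UD∣ k<∣VD∣ (inj₂ v) (inj₁ u) v∈ u∈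
  with u′ , u′v , _ ← commonNeighbourV D kd k<∣UD∣ v∈ v∈
  with v′ , u′v′ , uv′ ← commonNeighbourU D kd k<∣VD∣ (ED⊆UD D u′ v u′v) u∈
  = 3 , ≤-refl , step {y = inj₁ u′} u′v (step {y = inj₂ v′} u′v′ (step uv′ here))
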